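{- If $S=\{2,4,\ldots,2k\}\subseteq\mathbf n$, then $\dim_F\langle v_S\rangle=c_{k+1}$, where $c_m=\frac{1}{m+1}\binom{2m}{m}$ is the $m$-th Catalan number.
   Context: $\mathbf n=\{1,\ldots,n\}$. $\mathcal{IC}_n$ is the monoid (under composition) of all injective partial maps $f$ from $D(f)\subseteq\mathbf n$ onto a subset of $\mathbf n$ that are order preserving and order decreasing ($f(a)\le a$); the empty map is included. $F$ is a field of characteristic $0$; $V$ has $F$-basis $\{v_S:S\subseteq\mathbf n\}$ with action $f\cdot v_S=v_{f(S)}$ if $S\subseteq D(f)$ and $0$ otherwise; $\langle v_S\rangle$ is the $\mathcal{IC}_n$-submodule generated by $v_S$. -}

module Defs where

open import Level using (Level; _⊔_) renaming (suc to lsuc)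
open import Algebra.Bundles using (CommutativeRing)
open import Data.Nat as ℕ using (ℕ; zero; suc; _<ᵇ_)
open import Data.Nat.Combinatorics using (_C_)
open import Data.Nat.DivMod using (_/_)
open import Data.Nat.Base using (_%_)
open import Data.Bool as Bool using (Bool; true; false; _∧_)
open import Data.Fin as Fin using (Fin; toℕ)
open import Data.Fin.Properties using (any?)
open import Data.Fin.Subset using (Subset; _∈_; _⊆_)
open import Data.Fin.Subset.Properties using (_∈?_; _⊆?_)
open import Data.Maybe using (Maybe; just; nothing; is-just)
import Data.Maybe.Properties as MaybeP
import Data.Vec.Properties as VecP
open import Data.Vec as Vec using (Vec; []; _∷_; tabulate)
open import Data.List as List using (List; []; _∷_; _++_)
open import Data.Product using (Σ; ∃; _×_; _,_)
open import Data.Vec.Relation.Unary.All using (All)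
open import Relation.Nullary using (¬_; Dec; yes; no)
open import Relation.Nullary.Decidable using (⌊_⌋; _×-dec_)
open import Relation.Binary.PropositionalEquality using (_≡_)

record Field (c ℓ : Level) : Set (lsuc (c ⊔ ℓ)) where
  field
    commutativeRing : CommutativeRing c ℓ
  open CommutativeRing commutativeRing public
  field
    0≉1     : ¬ (0# ≈ 1#)
    inverse : ∀ x → ¬ (x ≈ 0#) → ∃ λ y → (x * y) ≈ 1#

  natF : ℕ → Carrier
  natF zero    = 0#
  natF (suc m) = 1# + natF m

  CharZero : Set ℓ
  CharZero = ∀ m → ¬ (natF (suc m) ≈ 0#)

catalan : ℕ → ℕ
catalan m = ((2 ℕ.* m) C m) / suc m

-- The set {1,…,n} is represented by Fin n, with
-- i : Fin n standing for the number toℕ i + 1 (the order is preserved).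

record IC (n : ℕ) : Set where
  field
    fun  : Fin n → Maybe (Fin n)
    inj  : ∀ {a b c} → fun a ≡ just c → fun b ≡ just c → a ≡ b
    mono : ∀ {a b c d} → fun a ≡ just c → fun b ≡ just d → a Fin.≤ b → c Fin.≤ d
    decr : ∀ {a c} → fun a ≡ just c → c Fin.≤ a
open IC public

dom : ∀ {n} → IC n → Subset n
dom f = tabulate (λ a → is-just (fun f a))

img : ∀ {n} → IC n → Subset n → Subset n
img f S = tabulate (λ x → ⌊ any? (λ a → (a ∈? S) ×-dec MaybeP.≡-dec Fin._≟_ (fun f a) (just x)) ⌋)

-- S = {2,4,…,2k} ⊆ {1,…,n}; in the Fin n encoding: {i | toℕ i odd, toℕ i < 2k}
evens : (n k : ℕ) → Subset n
evens n k = tabulate (λ i → (toℕ i % 2 ℕ.≡ᵇ 1) ∧ (toℕ i <ᵇ 2 ℕ.* k))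

-- The module V over a field F: elements are formal F-linear combinations
-- of the basis vectors v_S (S ⊆ n), represented as lists of
-- (coefficient, S) pairs, compared by their coefficient functions.

module IModule {c ℓ : Level} (F : Field c ℓ) (n : ℕ) where
  open Field F using (Carrier; _≈_; _+_; _*_; 0#; 1#)

  V : Set c
  V = List (Carrier × Subset n)

  v : Subset n → V
  v S = (1# , S) ∷ []

  coeff : V → Subset n → Carrier
  coeff []            T = 0#
  coeff ((a , S) ∷ w) T with VecP.≡-dec Bool._≟_ S T
  ... | yes _ = a + coeff w T
  ... | no  _ = coeff w T

  _≈V_ : V → V → Set ℓ
  w ≈V u = ∀ T → coeff w T ≈ coeff u T

  0V : V
  0V = []

  _+V_ : V → V → V
  _+V_ = _++_

  _·V_ : Carrier → V → V
  a ·V w = List.map (λ { (b , S) → (a * b , S) }) w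

  act : IC n → V → V
  act f []            = []
  act f ((a , S) ∷ w) with S ⊆? dom f
  ... | yes _ = (a , img f S) ∷ act f w
  ... | no  _ = act f w

  data ⟨_⟩ (x : V) : V → Set (c ⊔ ℓ) where
    gen   : ⟨ x ⟩ x
    zer   : ⟨ x ⟩ 0V
    add   : ∀ {w u} → ⟨ x ⟩ w → ⟨ x ⟩ u → ⟨ x ⟩ (w +V u)
    scale : ∀ a {w} → ⟨ x ⟩ w → ⟨ x ⟩ (a ·V w)
    acted : ∀ f {w} → ⟨ x ⟩ w → ⟨ x ⟩ (act f w)
    resp  : ∀ {w u} → w ≈V u → ⟨ x ⟩ w → ⟨ x ⟩ u

  lincomb : ∀ {d} → Vec Carrier d → Vec V d → V
  lincomb []       []       = 0V
  lincomb (a ∷ cs) (b ∷ bs) = (a ·V b) +V lincomb cs bs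

  LinIndep : ∀ {d} → Vec V d → Set (c ⊔ ℓ)
  LinIndep B = ∀ cs → lincomb cs B ≈V 0V → All (λ a → a ≈ 0#) cs

  HasDim : ∀ {p} → (V → Set p) → ℕ → Set (c ⊔ ℓ ⊔ p)
  HasDim P d = Σ (Vec V d) λ B →
      All P B × LinIndep B × (∀ w → P w → ∃ λ cs → lincomb cs B ≈V w)

-- Every f ∈ IC_n sends a basis vector v_T either to 0 or to the basis vector v_{f(T)}.
-- Hence ⟨v_S⟩ is spanned by the v_T with T in the orbit {f(S) | S ⊆ D(f)}, and these
-- distinct basis vectors are linearly independent. For S = {2, 4, …, 2k} the orbit
-- consists of the k-sets {t₁ < … < t_k} with tᵢ ≤ 2i: a map of IC_n defined on S sends
-- 2i to some tᵢ ≤ 2i, in increasing order, and conversely 2i ↦ tᵢ is a map of IC_n.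
-- Read as 0/1 words these sets obey a ballot condition, and the ballot theorem counts
-- them as C(2k+2, k+1)/(k+2) = c_{k+1}.

module Submission where

open import Level using (Level)
open import Data.Nat using (ℕ)
open import Defs

module BallotNumbers where

  open import Data.Nat using (ℕ; zero; suc; _+_; _*_; _∸_; z≤n; s≤s; _/_)
  open import Data.Nat.Properties
  open import Data.Nat.Combinatorics using (_C_; nCk≡nC[n∸k]; nC1≡n; nCk+nC[k+1]≡[n+1]C[k+1]; k>n⇒nCk≡0)
  open import Data.Nat.DivMod using (m*n/n≡m)
  open import Data.Nat.Tactic.RingSolver using (solve-∀)
  open import Relation.Binary.PropositionalEquality
  open import Algebra.Properties.CommutativeSemigroup +-commutativeSemigroup using (interchange)

  -- Placements of p ones in a 0/1 word when the next one is due within the next w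
  -- positions and every one placed extends that deadline by two positions.
  ballot : ℕ → ℕ → ℕ
  ballot zero    w       = 1
  ballot (suc p) zero    = 0
  ballot (suc p) (suc w) = ballot p (suc (suc w)) + ballot (suc p) w

  ballot-1 : ∀ w → ballot 1 w ≡ w
  ballot-1 zero    = refl
  ballot-1 (suc w) = cong suc (ballot-1 w)

  pascal : ∀ n k → n C k + n C suc k ≡ suc n C suc k
  pascal = nCk+nC[k+1]≡[n+1]C[k+1]

  [1+2p]Cp≡[1+2p]C[1+p] : ∀ p → suc (p + p) C p ≡ suc (p + p) C suc p
  [1+2p]Cp≡[1+2p]C[1+p] p = sym (begin
    suc (p + p) C suc p                 ≡⟨ nCk≡nC[n∸k] (s≤s (m≤m+n p p)) ⟩
    suc (p + p) C (suc (p + p) ∸ suc p) ≡⟨ cong (suc (p + p) C_) (m+n∸n≡m p p) ⟩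
    suc (p + p) C p                     ∎)
    where open ≡-Reasoning

  width : ℕ → ℕ → ℕ
  width p w = suc (p + p + w)

  -- The ballot theorem ballot (1 + p) w = C(2p+w+1, p+1) − C(2p+w+1, p), rearranged
  -- to avoid truncated subtraction.
  ballot+C≡C : ∀ p w → ballot (suc p) w + width p w C p ≡ width p w C suc p
  ballot+C≡C p zero = begin
    suc (p + p + 0) C p    ≡⟨ cong (λ m → suc m C p) (+-identityʳ (p + p)) ⟩
    suc (p + p) C p        ≡⟨ [1+2p]Cp≡[1+2p]C[1+p] p ⟩
    suc (p + p) C suc p    ≡⟨ cong (λ m → suc m C suc p) (+-identityʳ (p + p)) ⟨
    suc (p + p + 0) C suc p ∎
    where open ≡-Reasoning
  ballot+C≡C zero (suc w) = begin
    ballot 1 (suc w) + width 0 (suc w) C 0 ≡⟨ cong (λ m → suc (m + 1)) (ballot-1 w) ⟩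
    suc (w + 1)                            ≡⟨ cong suc (+-comm w 1) ⟩
    suc (suc w)                            ≡⟨ nC1≡n (suc (suc w)) ⟨
    width 0 (suc w) C 1                    ∎
    where open ≡-Reasoning
  ballot+C≡C (suc p) (suc w) = begin
    (a + b) + width (suc p) (suc w) C suc p ≡⟨ cong (λ m → (a + b) + m C suc p) width≡ ⟩
    (a + b) + suc X C suc p                 ≡⟨ cong ((a + b) +_) (pascal X p) ⟨
    (a + b) + (X C p + X C suc p)           ≡⟨ interchange a b (X C p) (X C suc p) ⟩
    (a + X C p) + (b + X C suc p)
      ≡⟨ cong₂ _+_ (ballot+C≡C p (suc (suc w)))
                   (subst (λ m → b + m C suc p ≡ m C suc (suc p)) width≡′ (ballot+C≡C (suc p) w)) ⟩
    X C suc p + X C suc (suc p)             ≡⟨ pascal X (suc p) ⟩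
    suc X C suc (suc p)                     ≡⟨ cong (λ m → m C suc (suc p)) width≡ ⟨
    width (suc p) (suc w) C suc (suc p)     ∎
    where
    open ≡-Reasoning
    X = width p (suc (suc w))
    a = ballot (suc p) (suc (suc w))
    b = ballot (suc (suc p)) w
    width≡ : width (suc p) (suc w) ≡ suc X
    width≡ = cong suc (shift p w)
      where
      shift : ∀ p w → suc p + suc p + suc w ≡ suc (p + p + suc (suc w))
      shift = solve-∀
    width≡′ : width (suc p) w ≡ X
    width≡′ = cong suc (shift p w)
      where
      shift : ∀ p w → suc p + suc p + w ≡ p + p + suc (suc w)
      shift = solve-∀

  absorption : ∀ n r → suc r * (suc n C suc r) ≡ suc n * (n C r)
  absorption zero    zero    = refl
  absorption zero    (suc r) = trans (cong (suc (suc r) *_) (k>n⇒nCk≡0 {1} {suc (suc r)} (s≤s (s≤s z≤n))))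
                                     (*-zeroʳ (suc (suc r)))
  absorption (suc m) zero    = trans (+-identityʳ _) (trans (nC1≡n (suc (suc m))) (sym (*-identityʳ (suc (suc m)))))
  absorption (suc m) (suc s) = begin
    suc (suc s) * (suc (suc m) C suc (suc s))         ≡⟨ cong (suc (suc s) *_) (pascal (suc m) (suc s)) ⟨
    suc (suc s) * (suc m C suc s + suc m C suc (suc s)) ≡⟨ rearrange s (suc m C suc s) (suc m C suc (suc s)) ⟩
    suc m C suc s + suc s * (suc m C suc s) + suc (suc s) * (suc m C suc (suc s))
      ≡⟨ cong₂ (λ x y → suc m C suc s + x + y) (absorption m s) (absorption m (suc s)) ⟩
    suc m C suc s + suc m * (m C s) + suc m * (m C suc s) ≡⟨ +-assoc (suc m C suc s) _ _ ⟩
    suc m C suc s + (suc m * (m C s) + suc m * (m C suc s))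
      ≡⟨ cong (suc m C suc s +_) (*-distribˡ-+ (suc m) (m C s) (m C suc s)) ⟨
    suc m C suc s + suc m * (m C s + m C suc s)         ≡⟨ cong (λ x → suc m C suc s + suc m * x) (pascal m s) ⟩
    suc (suc m) * (suc m C suc s)                       ∎
    where
    open ≡-Reasoning
    rearrange : ∀ s a b → suc (suc s) * (a + b) ≡ a + suc s * a + suc (suc s) * b
    rearrange = solve-∀

  ballot≡catalan : ∀ k → ballot k 2 ≡ catalan (suc k)
  ballot≡catalan zero    = refl
  ballot≡catalan (suc p) = begin
    ballot (suc p) 2                            ≡⟨ m*n/n≡m (ballot (suc p) 2) (3 + p) ⟨
    (ballot (suc p) 2 * (3 + p)) / (3 + p)      ≡⟨ cong (_/ (3 + p)) ballot*[3+p]≡A+A ⟩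
    (A + A) / (3 + p)                           ≡⟨ cong (λ m → (A + m) / (3 + p)) XC[2+p]≡A ⟨
    (A + X C suc (suc p)) / (3 + p)             ≡⟨ cong (_/ (3 + p)) (pascal X (suc p)) ⟩
    (suc X C suc (suc p)) / (3 + p)             ≡⟨ cong (λ m → (m C suc (suc p)) / (3 + p)) 2*[2+p]≡1+X ⟨
    catalan (suc (suc p))                       ∎
    where
    open ≡-Reasoning
    X = width p 2
    A = X C suc p
    B = X C p

    2*[2+p]≡1+X : 2 * suc (suc p) ≡ suc X
    2*[2+p]≡1+X = by-ring p
      where
      by-ring : ∀ p → 2 * suc (suc p) ≡ suc (suc (p + p + 2))
      by-ring = solve-∀

    XC[2+p]≡A : X C suc (suc p) ≡ A
    XC[2+p]≡A = subst (λ m → suc m C suc (suc p) ≡ suc m C suc p) (by-ring p)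
                      (sym ([1+2p]Cp≡[1+2p]C[1+p] (suc p)))
      where
      by-ring : ∀ p → suc p + suc p ≡ p + p + 2
      by-ring = solve-∀

    [1+p]*A≡[3+p]*B : suc p * A ≡ (3 + p) * B
    [1+p]*A≡[3+p]*B = +-cancelˡ-≡ (suc p * B) _ _ (begin
      suc p * B + suc p * A ≡⟨ *-distribˡ-+ (suc p) B A ⟨
      suc p * (B + A)       ≡⟨ cong (suc p *_) (pascal X p) ⟩
      suc p * (suc X C suc p) ≡⟨ absorption X p ⟩
      suc X * B             ≡⟨ by-ring p B ⟩
      suc p * B + (3 + p) * B ∎)
      where
      by-ring : ∀ p B → suc (suc (p + p + 2)) * B ≡ suc p * B + (3 + p) * B
      by-ring = solve-∀

    ballot*[3+p]≡A+A : ballot (suc p) 2 * (3 + p) ≡ A + A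
    ballot*[3+p]≡A+A = +-cancelʳ-≡ (suc p * A) _ _ (begin
      ballot (suc p) 2 * (3 + p) + suc p * A     ≡⟨ cong (ballot (suc p) 2 * (3 + p) +_) [1+p]*A≡[3+p]*B ⟩
      ballot (suc p) 2 * (3 + p) + (3 + p) * B   ≡⟨ by-ring₁ (ballot (suc p) 2) p B ⟩
      (3 + p) * (ballot (suc p) 2 + B)           ≡⟨ cong ((3 + p) *_) (ballot+C≡C p 2) ⟩
      (3 + p) * A                                ≡⟨ by-ring₂ p A ⟩
      A + A + suc p * A                          ∎)
      where
      by-ring₁ : ∀ N p B → N * (3 + p) + (3 + p) * B ≡ (3 + p) * (N + B)
      by-ring₁ = solve-∀
      by-ring₂ : ∀ p A → (3 + p) * A ≡ A + A + suc p * A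
      by-ring₂ = solve-∀

open BallotNumbers

module BallotWords where

  open import Data.Nat using (ℕ; zero; suc; _+_; _*_; _≤_; s≤s)
  open import Data.Nat.Properties
  open import Data.Nat.Tactic.RingSolver using (solve-∀)
  open import Data.Bool using (Bool; true; false)
  open import Data.Vec using (Vec; []; _∷_; replicate)
  import Data.Vec.Properties as VecP
  open import Data.List using (List; []; _∷_; _++_; map; length)
  open import Data.List.Properties using (length-++; length-map)
  open import Data.List.Membership.Propositional using (_∈_)
  open import Data.List.Membership.Propositional.Properties using (∈-map⁺; ∈-map⁻; ∈-++⁺ˡ; ∈-++⁺ʳ; ∈-++⁻)
  open import Data.List.Relation.Unary.All using ([])
  open import Data.List.Relation.Unary.AllPairs using ([]; _∷_)
  open import Data.List.Relation.Unary.Any using (here)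
  open import Data.List.Relation.Unary.Unique.Propositional using (Unique)
  import Data.List.Relation.Unary.Unique.Propositional.Properties as Unique
  open import Data.Product using (_,_; _×_)
  open import Data.Sum using (inj₁; inj₂)
  open import Relation.Nullary using (¬_; contradiction)
  open import Relation.Binary.PropositionalEquality

  ballots : (m p w : ℕ) → List (Vec Bool m)
  ballots m       zero    w       = replicate m false ∷ []
  ballots zero    (suc p) w       = []
  ballots (suc m) (suc p) zero    = []
  ballots (suc m) (suc p) (suc w) =
    map (true ∷_) (ballots m p (suc (suc w))) ++ map (false ∷_) (ballots m (suc p) w)

  data BallotWord : (m p w : ℕ) → Vec Bool m → Set where
    done : ∀ {m w} → BallotWord m 0 w (replicate m false)
    mark : ∀ {m p w V} → BallotWord m p (suc (suc w)) V → BallotWord (suc m) (suc p) (suc w) (true ∷ V)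
    skip : ∀ {m p w V} → BallotWord m (suc p) w V → BallotWord (suc m) (suc p) (suc w) (false ∷ V)

  ∈-ballots⁺ : ∀ {m p w V} → BallotWord m p w V → V ∈ ballots m p w
  ∈-ballots⁺ done                    = here refl
  ∈-ballots⁺ (mark b)                = ∈-++⁺ˡ (∈-map⁺ (true ∷_) (∈-ballots⁺ b))
  ∈-ballots⁺ (skip {m} {p} {w} b)    =
    ∈-++⁺ʳ (map (true ∷_) (ballots m p (suc (suc w)))) (∈-map⁺ (false ∷_) (∈-ballots⁺ b))

  ∈-ballots⁻ : ∀ m p w {V} → V ∈ ballots m p w → BallotWord m p w V
  ∈-ballots⁻ m       zero    w       (here refl) = done
  ∈-ballots⁻ (suc m) (suc p) (suc w) V∈ with ∈-++⁻ (map (true ∷_) (ballots m p (suc (suc w)))) V∈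
  ... | inj₁ V∈ˡ with ∈-map⁻ (true ∷_) V∈ˡ
  ...   | _ , U∈ , refl = mark (∈-ballots⁻ m p (suc (suc w)) U∈)
  ∈-ballots⁻ (suc m) (suc p) (suc w) V∈ | inj₂ V∈ʳ with ∈-map⁻ (false ∷_) V∈ʳ
  ...   | _ , U∈ , refl = skip (∈-ballots⁻ m (suc p) w U∈)

  ballots-unique : ∀ m p w → Unique (ballots m p w)
  ballots-unique m       zero    w       = [] ∷ []
  ballots-unique zero    (suc p) w       = []
  ballots-unique (suc m) (suc p) zero    = []
  ballots-unique (suc m) (suc p) (suc w) =
    Unique.++⁺ (Unique.map⁺ VecP.∷-injectiveʳ (ballots-unique m p (suc (suc w))))
               (Unique.map⁺ VecP.∷-injectiveʳ (ballots-unique m (suc p) w))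
               marked∩skipped≡∅
    where
    marked∩skipped≡∅ : ∀ {V} → ¬ (V ∈ map (true ∷_) (ballots m p (suc (suc w))) × V ∈ map (false ∷_) (ballots m (suc p) w))
    marked∩skipped≡∅ (V∈ˡ , V∈ʳ) with ∈-map⁻ (true ∷_) V∈ˡ | ∈-map⁻ (false ∷_) V∈ʳ
    ... | _ , _ , refl | _ , _ , ()

  length-ballots : ∀ m p w → p + p + w ≤ 2 + m → length (ballots m p w) ≡ ballot p w
  length-ballots m       zero    w       _ = refl
  length-ballots zero    (suc p) zero    _ = refl
  length-ballots zero    (suc p) (suc w) le = contradiction (subst (_≤ 2) (by-ring p w) le) λ { (s≤s (s≤s ())) }
    where
    by-ring : ∀ p w → suc p + suc p + suc w ≡ 3 + (p + p + w)
    by-ring = solve-∀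
  length-ballots (suc m) (suc p) zero    _ = refl
  length-ballots (suc m) (suc p) (suc w) le = begin
    length (map (true ∷_) marked ++ map (false ∷_) skipped)        ≡⟨ length-++ (map (true ∷_) marked) ⟩
    length (map (true ∷_) marked) + length (map (false ∷_) skipped) ≡⟨ cong₂ _+_ (length-map _ marked) (length-map _ skipped) ⟩
    length marked + length skipped
      ≡⟨ cong₂ _+_ (length-ballots m p (suc (suc w)) (≤-pred (subst (_≤ 3 + m) (shift₁ p w) le)))
                   (length-ballots m (suc p) w (≤-pred (subst (_≤ 3 + m) (shift₂ p w) le))) ⟩
    ballot p (suc (suc w)) + ballot (suc p) w                      ∎
    where
    open ≡-Reasoning
    marked = ballots m p (suc (suc w))
    skipped = ballots m (suc p) w
    shift₁ : ∀ p w → suc p + suc p + suc w ≡ suc (p + p + suc (suc w))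
    shift₁ = solve-∀
    shift₂ : ∀ p w → suc p + suc p + suc w ≡ suc (suc p + suc p + w)
    shift₂ = solve-∀

  length-ballots≡catalan : ∀ m k → 2 * k ≤ m → length (ballots m k 2) ≡ catalan (suc k)
  length-ballots≡catalan m k 2k≤m =
    trans (length-ballots m k 2 (subst (_≤ 2 + m) (by-ring k) (+-monoʳ-≤ 2 2k≤m))) (ballot≡catalan k)
    where
    by-ring : ∀ k → 2 + 2 * k ≡ k + k + 2
    by-ring = solve-∀

open BallotWords

module BallotSequences where

  open import Data.Nat using (ℕ; zero; suc; _+_; _≤_; _<_; z≤n; s≤s; _≟_)
  open import Data.Nat.Properties
  open import Data.Nat.Tactic.RingSolver using (solve-∀)
  open import Data.Bool using (Bool; false; _∨_)
  open import Data.Fin as Fin using (Fin; toℕ)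
  open import Data.Fin.Subset using () renaming (_∈_ to _∈ₛ_)
  open import Data.Vec using (Vec; []; _∷_; replicate; here; there)
  open import Data.List using (List; []; _∷_; length; map)
  open import Data.List.Membership.Propositional using (_∈_)
  open import Data.List.Membership.DecPropositional _≟_ using (_∈?_)
  open import Data.List.Relation.Unary.Any using (here; there)
  open import Data.Product using (∃; _×_; _,_)
  open import Data.Sum using (inj₁; inj₂)
  open import Function using (_∘_)
  open import Relation.Nullary using (does; yes; no; contradiction)
  open import Relation.Nullary.Decidable using (dec-true; dec-false)
  open import Relation.Binary.PropositionalEquality

  -- BallotSeq x b (y₀ ∷ y₁ ∷ …): x ≤ y₀ < y₁ < … and yᵢ ≤ b + 2i.
  data BallotSeq : ℕ → ℕ → List ℕ → Set where
    []   : ∀ {x b} → BallotSeq x b []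
    cons : ∀ {x b y t} → x ≤ y → y ≤ b → BallotSeq (suc y) (2 + b) t → BallotSeq x b (y ∷ t)

  BallotSeq-lower : ∀ {x b t z} → BallotSeq x b t → z ∈ t → x ≤ z
  BallotSeq-lower (cons x≤y _ _) (here refl) = x≤y
  BallotSeq-lower (cons x≤y _ t) (there z∈) = ≤-trans x≤y (<⇒≤ (BallotSeq-lower t z∈))

  BallotSeq-weaken : ∀ {x x′ b t} → x ≤ x′ → BallotSeq x′ b t → BallotSeq x b t
  BallotSeq-weaken _     []               = []
  BallotSeq-weaken x≤x′ (cons x′≤y y≤b t) = cons (≤-trans x≤x′ x′≤y) y≤b t

  BallotSeq-upper : ∀ {x b t z} → BallotSeq x b t → z ∈ t → 2 + z ≤ b + (length t + length t)
  BallotSeq-upper {b = b} {y ∷ t} (cons _ y≤b _) (here refl) = begin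
    2 + y                               ≤⟨ +-monoʳ-≤ 2 y≤b ⟩
    2 + b                               ≡⟨ +-comm 2 b ⟩
    b + 2                               ≤⟨ +-monoʳ-≤ b (s≤s (≤-trans (s≤s z≤n) (m≤n+m (suc (length t)) (length t)))) ⟩
    b + (suc (length t) + suc (length t)) ∎
    where open ≤-Reasoning
  BallotSeq-upper {b = b} {y ∷ t} (cons _ _ seq) (there z∈) = begin
    2 + _                               ≤⟨ BallotSeq-upper seq z∈ ⟩
    2 + b + (length t + length t)       ≡⟨ by-ring b (length t) ⟩
    b + (suc (length t) + suc (length t)) ∎
    where
    open ≤-Reasoning
    by-ring : ∀ b l → 2 + b + (l + l) ≡ b + (suc l + suc l)
    by-ring = solve-∀

  window : ℕ → (m : ℕ) → List ℕ → Vec Bool m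
  window x zero    t = []
  window x (suc m) t = does (x ∈? t) ∷ window (suc x) m t

  window-[] : ∀ x m → window x m [] ≡ replicate m false
  window-[] x zero    = refl
  window-[] x (suc m) = cong (false ∷_) (window-[] (suc x) m)

  window-below : ∀ {y x} m t → y < x → window x m (y ∷ t) ≡ window x m t
  window-below             zero    t y<x = refl
  window-below {y} {x} (suc m) t y<x =
    cong₂ _∷_ (cong (_∨ does (x ∈? t)) (dec-false (x ≟ y) (>⇒≢ y<x))) (window-below m t (m<n⇒m<1+n y<x))

  slack-after-mark : ∀ {x b w} → suc b ≡ x + suc w → suc (2 + b) ≡ suc x + (2 + w)
  slack-after-mark {x} {b} {w} slack = trans (cong (2 +_) slack) (by-ring x w)
    where
    by-ring : ∀ x w → 2 + (x + suc w) ≡ suc x + (2 + w)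
    by-ring = solve-∀

  -- With x the first admissible position, w = b + 1 − x counts the positions where
  -- the next element may still go.
  BallotSeq⇒BallotWord : ∀ {x b t} m w → BallotSeq x b t → suc b ≡ x + w → (∀ {z} → z ∈ t → z < x + m) →
                         BallotWord m (length t) w (window x m t)
  BallotSeq⇒BallotWord {x} m w [] _ _ = subst (BallotWord m 0 w) (sym (window-[] x m)) done
  BallotSeq⇒BallotWord {x} zero w (cons x≤y _ _) _ bound =
    contradiction (subst (_ <_) (+-identityʳ x) (bound (here refl))) (≤⇒≯ x≤y)
  BallotSeq⇒BallotWord {x} (suc m) zero (cons x≤y y≤b _) slack _ =
    contradiction (≤-trans x≤y y≤b) (<⇒≱ (≤-reflexive (trans slack (+-identityʳ x))))
  BallotSeq⇒BallotWord {x} {b} {y ∷ t} (suc m) (suc w) (cons x≤y y≤b seq) slack bound with m≤n⇒m<n∨m≡n x≤y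
  ... | inj₂ refl rewrite dec-true (x ∈? (x ∷ t)) (here refl) | window-below m t (n<1+n x) =
    mark (BallotSeq⇒BallotWord m (2 + w) seq (slack-after-mark slack)
                               (λ {z} z∈ → subst (z <_) (+-suc x m) (bound (there z∈))))
  ... | inj₁ x<y rewrite dec-false (x ∈? (y ∷ t)) (λ x∈ → <-irrefl refl (BallotSeq-lower (cons x<y y≤b seq) x∈)) =
    skip (BallotSeq⇒BallotWord m w (cons x<y y≤b seq) (trans slack (+-suc x w))
                               (λ {z} z∈ → subst (z <_) (+-suc x m) (bound z∈)))

  BallotWord⇒BallotSeq : ∀ {m p w V} → BallotWord m p w V → ∀ x b → suc b ≡ x + w →
                         ∃ λ t → BallotSeq x b t × length t ≡ p × V ≡ window x m t
  BallotWord⇒BallotSeq {m} done x b _ = [] , [] , refl , sym (window-[] x m)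
  BallotWord⇒BallotSeq (mark {m} word) x b slack with BallotWord⇒BallotSeq word (suc x) (2 + b) (slack-after-mark slack)
  ... | t , seq , refl , refl =
    x ∷ t , cons ≤-refl x≤b seq , refl ,
    sym (cong₂ _∷_ (dec-true (x ∈? (x ∷ t)) (here refl)) (window-below m t (n<1+n x)))
    where
    x≤b : x ≤ b
    x≤b = ≤-pred (subst (x <_) (sym slack) (m<m+n x (s≤s z≤n)))
  BallotWord⇒BallotSeq (skip {m} {w = w} word) x b slack with BallotWord⇒BallotSeq word (suc x) b (trans slack (+-suc x w))
  ... | t , seq , length≡ , refl =
    t , BallotSeq-weaken (n≤1+n x) seq , length≡ ,
    cong (_∷ window (suc x) m t) (sym (dec-false (x ∈? t) (λ x∈ → <-irrefl refl (BallotSeq-lower seq x∈))))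

  ∈-window⁺ : ∀ {x m t} {i : Fin m} → x + toℕ i ∈ t → i ∈ₛ window x m t
  ∈-window⁺ {x} {suc m} {t} {Fin.zero} x∈ rewrite dec-true (x ∈? t) (subst (_∈ t) (+-identityʳ x) x∈) = here
  ∈-window⁺ {x} {suc m} {t} {Fin.suc i} x+i∈ = there (∈-window⁺ (subst (_∈ t) (+-suc x (toℕ i)) x+i∈))

  ∈-window⁻ : ∀ {x m t} {i : Fin m} → i ∈ₛ window x m t → x + toℕ i ∈ t
  ∈-window⁻ {x} {suc m} {t} {Fin.zero} i∈ with x ∈? t
  ... | yes x∈ = subst (_∈ t) (sym (+-identityʳ x)) x∈
  ... | no _ with i∈
  ...   | ()
  ∈-window⁻ {x} {suc m} {t} {Fin.suc i} (there i∈) = subst (_∈ t) (sym (+-suc x (toℕ i))) (∈-window⁻ i∈)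

  BallotSeq-map : ∀ (h : ℕ → ℕ) {x b t} x′ → BallotSeq x b t →
                  (∀ {y} → y ∈ t → h y ≤ y) →
                  (∀ {y y′} → y ∈ t → y′ ∈ t → y < y′ → h y < h y′) →
                  (∀ {y} → y ∈ t → x′ ≤ h y) →
                  BallotSeq x′ b (map h t)
  BallotSeq-map h x′ [] _ _ _ = []
  BallotSeq-map h x′ (cons _ y≤b seq) decr mono lower =
    cons (lower (here refl)) (≤-trans (decr (here refl)) y≤b)
         (BallotSeq-map h _ seq (decr ∘ there) (λ y∈ y′∈ → mono (there y∈) (there y′∈))
                        (λ y∈ → mono (here refl) (there y∈) (BallotSeq-lower seq y∈)))

open BallotSequences

module PartialMaps where

  open import Data.Nat using (ℕ; _≤_; _<_; _≟_; _<?_)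
  open import Data.Nat.Properties
  open import Data.Bool using (Bool; T)
  open import Data.Bool.Properties using (T-≡)
  open import Data.Unit using (tt)
  open import Data.Fin as Fin using (Fin; toℕ; fromℕ<)
  open import Data.Fin.Properties using (toℕ-injective; toℕ-fromℕ<; fromℕ<-toℕ; toℕ<n)
  open import Data.Fin.Subset using (Subset; _⊆_) renaming (_∈_ to _∈ₛ_)
  open import Data.Fin.Subset.Properties using (⊆-antisym)
  open import Data.Maybe using (Maybe; just; nothing; is-just; maybe; _>>=_)
  open import Data.Vec using (tabulate)
  open import Data.Vec.Properties using (lookup⇒[]=; []=⇒lookup; lookup∘tabulate)
  open import Data.List using (List; []; _∷_; map)
  open import Data.List.Membership.Propositional using (_∈_)
  open import Data.List.Membership.Propositional.Properties using (∈-map⁺; ∈-map⁻)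
  open import Data.List.Relation.Unary.All as All using (All; [])
  open import Data.List.Relation.Unary.Any using (here; there)
  open import Data.Product using (∃; ∃₂; _×_; _,_; proj₁; proj₂)
  open import Data.Sum using (_⊎_; inj₁; inj₂)
  open import Function using (_∘_; Equivalence)
  open import Relation.Nullary using (yes; no; contradiction)
  open import Relation.Nullary.Decidable using (toWitness; fromWitness)
  open import Relation.Binary.PropositionalEquality

  ∈-tabulate⁺ : ∀ {m} (f : Fin m → Bool) {i} → T (f i) → i ∈ₛ tabulate f
  ∈-tabulate⁺ f {i} fi = lookup⇒[]= i (tabulate f) (trans (lookup∘tabulate f i) (Equivalence.to T-≡ fi))

  ∈-tabulate⁻ : ∀ {m} (f : Fin m → Bool) {i} → i ∈ₛ tabulate f → T (f i)
  ∈-tabulate⁻ f {i} i∈ = Equivalence.from T-≡ (trans (sym (lookup∘tabulate f i)) ([]=⇒lookup i∈))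

  module _ {n : ℕ} (f : IC n) where

    ∈-img⁺ : ∀ {S a x} → a ∈ₛ S → fun f a ≡ just x → x ∈ₛ img f S
    ∈-img⁺ a∈ fa = ∈-tabulate⁺ _ (fromWitness (_ , a∈ , fa))

    ∈-img⁻ : ∀ {S x} → x ∈ₛ img f S → ∃ λ a → a ∈ₛ S × fun f a ≡ just x
    ∈-img⁻ x∈ = toWitness (∈-tabulate⁻ _ x∈)

    ∈-dom⁺ : ∀ {a c} → fun f a ≡ just c → a ∈ₛ dom f
    ∈-dom⁺ fa = ∈-tabulate⁺ _ (subst (T ∘ is-just) (sym fa) tt)

    ∈-dom⁻ : ∀ {a} → a ∈ₛ dom f → ∃ λ c → fun f a ≡ just c
    ∈-dom⁻ {a} a∈ with fun f a | ∈-tabulate⁻ (λ a → is-just (fun f a)) a∈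
    ... | just c | _ = c , refl

  toFin : ∀ {n} → ℕ → Maybe (Fin n)
  toFin {n} z with z <? n
  ... | yes z<n = just (fromℕ< z<n)
  ... | no _    = nothing

  toFin-toℕ : ∀ {n} (a : Fin n) → toFin (toℕ a) ≡ just a
  toFin-toℕ {n} a with toℕ a <? n
  ... | yes a<n = cong just (fromℕ<-toℕ a a<n)
  ... | no a≮n  = contradiction (toℕ<n a) a≮n

  toℕ-toFin : ∀ {n z} {c : Fin n} → toFin z ≡ just c → toℕ c ≡ z
  toℕ-toFin {n} {z} eq with z <? n
  toℕ-toFin refl | yes z<n = toℕ-fromℕ< z<n

  -- The action of f on positions, with junk value 0 off the domain.
  funℕ : ∀ {n} → IC n → ℕ → ℕ
  funℕ f y = maybe toℕ 0 (toFin y >>= fun f)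

  funℕ-toℕ : ∀ {n} (f : IC n) {a c} → fun f a ≡ just c → funℕ f (toℕ a) ≡ toℕ c
  funℕ-toℕ f {a} fa rewrite toFin-toℕ a | fa = refl

  toSub : ∀ {n} → List ℕ → Subset n
  toSub {n} = window 0 n

  ∈-toSub⁺ : ∀ {n t} {a : Fin n} → toℕ a ∈ t → a ∈ₛ toSub t
  ∈-toSub⁺ = ∈-window⁺

  ∈-toSub⁻ : ∀ {n t} {a : Fin n} → a ∈ₛ toSub t → toℕ a ∈ t
  ∈-toSub⁻ = ∈-window⁻

  module _ {n : ℕ} (f : IC n) {t : List ℕ} (t<n : ∀ {y} → y ∈ t → y < n) (t⊆dom : toSub t ⊆ dom f) where

    private
      defined : ∀ {y} → y ∈ t → ∃₂ λ a c → toℕ a ≡ y × fun f a ≡ just c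
      defined y∈ with ∈-dom⁻ f (t⊆dom (∈-toSub⁺ (subst (_∈ t) (sym (toℕ-fromℕ< (t<n y∈))) y∈)))
      ... | c , fa = fromℕ< (t<n y∈) , c , toℕ-fromℕ< (t<n y∈) , fa

    funℕ-decreasing : ∀ {y} → y ∈ t → funℕ f y ≤ y
    funℕ-decreasing y∈ with defined y∈
    ... | a , c , refl , fa = subst (_≤ toℕ a) (sym (funℕ-toℕ f fa)) (decr f fa)

    funℕ-strictMono : ∀ {y y′} → y ∈ t → y′ ∈ t → y < y′ → funℕ f y < funℕ f y′
    funℕ-strictMono y∈ y′∈ y<y′ with defined y∈ | defined y′∈
    ... | a , c , refl , fa | a′ , c′ , refl , fa′ rewrite funℕ-toℕ f fa | funℕ-toℕ f fa′ =
      ≤∧≢⇒< (mono f fa fa′ (<⇒≤ y<y′))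
            (λ c≡c′ → <⇒≢ y<y′ (cong toℕ (inj f fa (subst (λ d → fun f a′ ≡ just d) (sym (toℕ-injective c≡c′)) fa′))))

    img-toSub : img f (toSub t) ≡ toSub (map (funℕ f) t)
    img-toSub = ⊆-antisym img⊆ ⊇img
      where
      img⊆ : img f (toSub t) ⊆ toSub (map (funℕ f) t)
      img⊆ x∈ with ∈-img⁻ f x∈
      ... | a , a∈ , fa = ∈-toSub⁺ (subst (λ z → z ∈ map (funℕ f) t) (funℕ-toℕ f fa) (∈-map⁺ (funℕ f) (∈-toSub⁻ a∈)))
      ⊇img : toSub (map (funℕ f) t) ⊆ img f (toSub t)
      ⊇img {x} x∈ with ∈-map⁻ (funℕ f) (∈-toSub⁻ x∈)
      ... | y , y∈ , x≡ with defined y∈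
      ...   | a , c , refl , fa =
        ∈-img⁺ f (∈-toSub⁺ y∈) (subst (λ d → fun f a ≡ just d) (toℕ-injective (sym (trans x≡ (funℕ-toℕ f fa)))) fa)

  -- Sorted graphs of order-preserving, order-decreasing partial injections on ℕ.
  data ICGraph : List (ℕ × ℕ) → Set where
    []   : ICGraph []
    cons : ∀ {y z ps} → z ≤ y → All (λ p → y < proj₁ p × z < proj₂ p) ps → ICGraph ps → ICGraph ((y , z) ∷ ps)

  ICGraph-decreasing : ∀ {ps y z} → ICGraph ps → (y , z) ∈ ps → z ≤ y
  ICGraph-decreasing (cons z≤y _ _) (here refl) = z≤y
  ICGraph-decreasing (cons _ _ g)   (there p∈)  = ICGraph-decreasing g p∈

  ICGraph-ordered : ∀ {ps y z y′ z′} → ICGraph ps → (y , z) ∈ ps → (y′ , z′) ∈ ps →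
                    (y ≡ y′ × z ≡ z′) ⊎ (y < y′ × z < z′) ⊎ (y′ < y × z′ < z)
  ICGraph-ordered _              (here refl) (here refl)  = inj₁ (refl , refl)
  ICGraph-ordered (cons _ above _) (here refl) (there p′∈) = inj₂ (inj₁ (All.lookup above p′∈))
  ICGraph-ordered (cons _ above _) (there p∈)  (here refl) = inj₂ (inj₂ (All.lookup above p∈))
  ICGraph-ordered (cons _ _ g)     (there p∈)  (there p′∈) = ICGraph-ordered g p∈ p′∈

  apply : List (ℕ × ℕ) → ℕ → Maybe ℕ
  apply []             y = nothing
  apply ((y′ , z) ∷ ps) y with y′ ≟ y
  ... | yes _ = just z
  ... | no  _ = apply ps y

  apply-∈ : ∀ ps {y z} → apply ps y ≡ just z → (y , z) ∈ ps
  apply-∈ ((y′ , z′) ∷ ps) {y} eq with y′ ≟ y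
  apply-∈ ((y′ , z′) ∷ ps) refl | yes refl = here refl
  ... | no _ = there (apply-∈ ps eq)

  ∈-apply : ∀ {ps y z} → ICGraph ps → (y , z) ∈ ps → apply ps y ≡ just z
  ∈-apply {(y′ , z′) ∷ ps} {y} (cons _ above g) p∈ with y′ ≟ y | p∈
  ... | yes _       | here refl = refl
  ... | yes refl    | there p′∈ = contradiction (proj₁ (All.lookup above p′∈)) (<-irrefl refl)
  ... | no y′≢y     | here refl = contradiction refl y′≢y
  ... | no _        | there p′∈ = ∈-apply g p′∈

  module _ {n : ℕ} {ps : List (ℕ × ℕ)} (g : ICGraph ps) where

    graphFun : Fin n → Maybe (Fin n)
    graphFun a = apply ps (toℕ a) >>= toFin

    graphFun-∈ : ∀ {a c} → graphFun a ≡ just c → (toℕ a , toℕ c) ∈ ps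
    graphFun-∈ {a} eq with apply ps (toℕ a) in app
    ... | just z = subst (λ z → (toℕ a , z) ∈ ps) (sym (toℕ-toFin eq)) (apply-∈ ps app)

    ∈-graphFun : ∀ {a c} → (toℕ a , toℕ c) ∈ ps → graphFun a ≡ just c
    ∈-graphFun {a} {c} p∈ rewrite ∈-apply g p∈ = toFin-toℕ c

    graphMap : IC n
    graphMap = record { fun = graphFun ; inj = injective ; mono = monotone ; decr = decreasing }
      where
      injective : ∀ {a b c} → graphFun a ≡ just c → graphFun b ≡ just c → a ≡ b
      injective fa fb with ICGraph-ordered g (graphFun-∈ fa) (graphFun-∈ fb)
      ... | inj₁ (a≡b , _)        = toℕ-injective a≡b
      ... | inj₂ (inj₁ (_ , c<c)) = contradiction c<c (<-irrefl refl)
      ... | inj₂ (inj₂ (_ , c<c)) = contradiction c<c (<-irrefl refl)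
      monotone : ∀ {a b c d} → graphFun a ≡ just c → graphFun b ≡ just d → a Fin.≤ b → c Fin.≤ d
      monotone fa fb a≤b with ICGraph-ordered g (graphFun-∈ fa) (graphFun-∈ fb)
      ... | inj₁ (_ , c≡d)        = ≤-reflexive c≡d
      ... | inj₂ (inj₁ (_ , c<d)) = <⇒≤ c<d
      ... | inj₂ (inj₂ (b<a , _)) = contradiction a≤b (<⇒≱ b<a)
      decreasing : ∀ {a c} → graphFun a ≡ just c → c Fin.≤ a
      decreasing fa = ICGraph-decreasing g (graphFun-∈ fa)

open PartialMaps

module OrbitOfEvens where

  open import Data.Nat using (ℕ; zero; suc; _+_; _*_; _≤_; _<_; z≤n; s≤s; _%_; _/_)
  open import Data.Nat.Properties
  open import Data.Nat.DivMod using (m≡m%n+[m/n]*n; [m+kn]%n≡m%n; m<n*o⇒m/o<n)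
  open import Data.Nat.Tactic.RingSolver using (solve-∀)
  open import Data.Bool.Properties using (T-∧)
  open import Data.Fin using (toℕ; fromℕ<)
  open import Data.Fin.Properties using (toℕ-fromℕ<)
  open import Data.Fin.Subset using (Subset; _⊆_) renaming (_∈_ to _∈ₛ_)
  open import Data.Fin.Subset.Properties using (⊆-antisym)
  open import Data.List using (List; []; _∷_; map; length)
  open import Data.List.Properties using (length-map)
  open import Data.List.Membership.Propositional using (_∈_)
  open import Data.List.Membership.Propositional.Properties using (∈-map⁺; ∈-map⁻)
  import Data.List.Relation.Unary.All as All
  open import Data.List.Relation.Unary.Any using (here; there)
  open import Data.Product using (∃; _×_; _,_; proj₁; proj₂)
  open import Data.Sum using (inj₁; inj₂)
  open import Function using (_∘_; Equivalence)
  open import Relation.Nullary using (contradiction)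
  open import Relation.Binary.PropositionalEquality

  -- In the encoding of Defs position i stands for i + 1, so odds 0 k encodes {2, 4, …, 2k}.
  odds : ℕ → ℕ → List ℕ
  odds j zero    = []
  odds j (suc l) = suc (j + j) ∷ odds (suc j) l

  length-odds : ∀ j l → length (odds j l) ≡ l
  length-odds j zero    = refl
  length-odds j (suc l) = cong suc (length-odds (suc j) l)

  ∈-odds⁻ : ∀ j l {y} → y ∈ odds j l → ∃ λ i → j ≤ i × i < j + l × y ≡ suc (i + i)
  ∈-odds⁻ j (suc l) (here refl) = j , ≤-refl , m<m+n j (s≤s z≤n) , refl
  ∈-odds⁻ j (suc l) (there y∈) with ∈-odds⁻ (suc j) l y∈
  ... | i , j<i , i<j+l , refl = i , <⇒≤ j<i , subst (i <_) (sym (+-suc j l)) i<j+l , refl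

  ∈-odds⁺ : ∀ j l {i} → j ≤ i → i < j + l → suc (i + i) ∈ odds j l
  ∈-odds⁺ j zero {i} j≤i i<j+0 = contradiction (subst (i <_) (+-identityʳ j) i<j+0) (≤⇒≯ j≤i)
  ∈-odds⁺ j (suc l) {i} j≤i i<j+l with m≤n⇒m<n∨m≡n j≤i
  ... | inj₂ refl = here refl
  ... | inj₁ j<i  = there (∈-odds⁺ (suc j) l j<i (subst (i <_) (+-suc j l) i<j+l))

  odds-ballotSeq : ∀ j l {x} → x ≤ suc (j + j) → BallotSeq x (suc (j + j)) (odds j l)
  odds-ballotSeq j zero    _   = []
  odds-ballotSeq j (suc l) x≤ =
    cons x≤ ≤-refl (subst (λ b → BallotSeq (2 + (j + j)) b (odds (suc j) l)) (cong (λ m → suc (suc m)) (+-suc j j))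
                          (odds-ballotSeq (suc j) l (s≤s (s≤s (+-monoʳ-≤ j (n≤1+n j))))))

  odd<2k⇒∈odds : ∀ {k y} → y % 2 ≡ 1 → y < 2 * k → y ∈ odds 0 k
  odd<2k⇒∈odds {k} {y} y%2≡1 y<2k = subst (_∈ odds 0 k) (sym y≡) (∈-odds⁺ 0 k z≤n (m<n*o⇒m/o<n (subst (y <_) (*-comm 2 k) y<2k)))
    where
    double : ∀ i → i * 2 ≡ i + i
    double = solve-∀
    y≡ : y ≡ suc (y / 2 + y / 2)
    y≡ = trans (m≡m%n+[m/n]*n y 2) (cong₂ _+_ y%2≡1 (double (y / 2)))

  ∈odds⇒odd<2k : ∀ {k y} → y ∈ odds 0 k → y % 2 ≡ 1 × y < 2 * k
  ∈odds⇒odd<2k {k} y∈ with ∈-odds⁻ 0 k y∈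
  ... | i , _ , i<k , refl = trans (cong (_% 2) (by-ring₁ i)) ([m+kn]%n≡m%n 1 i 2) ,
                            subst (_≤ 2 * k) (by-ring₂ i) (*-monoʳ-≤ 2 i<k)
    where
    by-ring₁ : ∀ i → suc (i + i) ≡ 1 + i * 2
    by-ring₁ = solve-∀
    by-ring₂ : ∀ i → 2 * suc i ≡ suc (suc (i + i))
    by-ring₂ = solve-∀

  ∈-evens⁻ : ∀ {n k i} → i ∈ₛ evens n k → toℕ i ∈ odds 0 k
  ∈-evens⁻ {k = k} i∈ with Equivalence.to T-∧ (∈-tabulate⁻ _ i∈)
  ... | odd , <2k = odd<2k⇒∈odds (≡ᵇ⇒≡ _ 1 odd) (<ᵇ⇒< _ (2 * k) <2k)

  ∈-evens⁺ : ∀ {n k i} → toℕ i ∈ odds 0 k → i ∈ₛ evens n k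
  ∈-evens⁺ i∈ with ∈odds⇒odd<2k i∈
  ... | odd , <2k = ∈-tabulate⁺ _ (Equivalence.from T-∧ (≡⇒≡ᵇ _ 1 odd , <⇒<ᵇ <2k))

  evens≡toSub-odds : ∀ n k → evens n k ≡ toSub (odds 0 k)
  evens≡toSub-odds n k = ⊆-antisym (∈-toSub⁺ ∘ ∈-evens⁻) (∈-evens⁺ ∘ ∈-toSub⁻)

  oddGraph : ℕ → List ℕ → List (ℕ × ℕ)
  oddGraph j []      = []
  oddGraph j (y ∷ t) = (suc (j + j) , y) ∷ oddGraph (suc j) t

  keys-oddGraph : ∀ j t → map proj₁ (oddGraph j t) ≡ odds j (length t)
  keys-oddGraph j []      = refl
  keys-oddGraph j (y ∷ t) = cong (suc (j + j) ∷_) (keys-oddGraph (suc j) t)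

  values-oddGraph : ∀ j t → map proj₂ (oddGraph j t) ≡ t
  values-oddGraph j []      = refl
  values-oddGraph j (y ∷ t) = cong (y ∷_) (values-oddGraph (suc j) t)

  ∈-oddGraph⁻ : ∀ j t {p} → p ∈ oddGraph j t → proj₁ p ∈ odds j (length t) × proj₂ p ∈ t
  ∈-oddGraph⁻ j t p∈ = subst (_ ∈_) (keys-oddGraph j t) (∈-map⁺ proj₁ p∈) ,
                       subst (_ ∈_) (values-oddGraph j t) (∈-map⁺ proj₂ p∈)

  oddGraph-ICGraph : ∀ j {x t} → BallotSeq x (suc (j + j)) t → ICGraph (oddGraph j t)
  oddGraph-ICGraph j []                       = []
  oddGraph-ICGraph j {t = y ∷ t} (cons _ y≤ seq) =
    cons y≤ (All.tabulate above) (oddGraph-ICGraph (suc j) seq′)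
    where
    seq′ : BallotSeq (suc y) (suc (suc j + suc j)) t
    seq′ = subst (λ b → BallotSeq (suc y) b t) (sym (cong (λ m → suc (suc m)) (+-suc j j))) seq
    above : ∀ {p} → p ∈ oddGraph (suc j) t → suc (j + j) < proj₁ p × y < proj₂ p
    above p∈ with ∈-oddGraph⁻ (suc j) t p∈
    ... | key∈ , value∈ with ∈-odds⁻ (suc j) (length t) key∈
    ...   | i , j<i , _ , key≡ = subst (suc (j + j) <_) (sym key≡) (s≤s (+-mono-< j<i j<i)) ,
                                 BallotSeq-lower seq value∈

  -- In the paper's 1-based numbering: T = {t₁ < … < t_k} with tᵢ ≤ 2i.
  BallotSet : (n k : ℕ) → Subset n → Set
  BallotSet n k T = ∃ λ t → BallotSeq 0 1 t × length t ≡ k × T ≡ toSub t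

  module _ {n k : ℕ} (2k≤n : 2 * k ≤ n) where

    ballotSeq<n : ∀ {t y} → BallotSeq 0 1 t → length t ≡ k → y ∈ t → y < n
    ballotSeq<n {t} {y} seq refl y∈ = ≤-trans (≤-pred (BallotSeq-upper seq y∈)) (subst (_≤ n) (double (length t)) 2k≤n)
      where
      double : ∀ l → 2 * l ≡ l + l
      double = solve-∀

    evens-ballotSet : BallotSet n k (evens n k)
    evens-ballotSet = odds 0 k , odds-ballotSeq 0 k z≤n , length-odds 0 k , evens≡toSub-odds n k

    img-ballotSet : ∀ (f : IC n) {T} → BallotSet n k T → T ⊆ dom f → BallotSet n k (img f T)
    img-ballotSet f (t , seq , refl , refl) T⊆dom =
      map (funℕ f) t ,
      BallotSeq-map (funℕ f) 0 seq (funℕ-decreasing f t<n T⊆dom) (funℕ-strictMono f t<n T⊆dom) (λ _ → z≤n) ,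
      length-map (funℕ f) t ,
      img-toSub f t<n T⊆dom
      where
      t<n : ∀ {y} → y ∈ t → y < n
      t<n = ballotSeq<n seq refl

    ballotSet-reachable : ∀ {T} → BallotSet n k T → ∃ λ f → evens n k ⊆ dom f × img f (evens n k) ≡ T
    ballotSet-reachable (t , seq , refl , refl) = f , evens⊆dom , ⊆-antisym img⊆ ⊇img
      where
      graph = oddGraph-ICGraph 0 seq
      f = graphMap graph

      reindex : ∀ {y} → y ∈ odds 0 k → ∃ λ a → toℕ a ≡ y × a ∈ₛ evens n k
      reindex {y} y∈ = fromℕ< y<n , toℕ-fromℕ< y<n , ∈-evens⁺ (subst (_∈ odds 0 k) (sym (toℕ-fromℕ< y<n)) y∈)
        where
        y<n = <-≤-trans (proj₂ (∈odds⇒odd<2k y∈)) 2k≤n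

      evens⊆dom : evens n k ⊆ dom f
      evens⊆dom {a} a∈ with ∈-map⁻ proj₁ (subst (toℕ a ∈_) (sym (keys-oddGraph 0 t)) (∈-evens⁻ a∈))
      ... | (y , z) , p∈ , refl = ∈-dom⁺ f (∈-graphFun graph (subst (λ z → (toℕ a , z) ∈ oddGraph 0 t) (sym (toℕ-fromℕ< z<n)) p∈))
        where
        z<n = ballotSeq<n seq refl (proj₂ (∈-oddGraph⁻ 0 t p∈))

      img⊆ : img f (evens n k) ⊆ toSub t
      img⊆ x∈ with ∈-img⁻ f x∈
      ... | a , _ , fa = ∈-toSub⁺ (proj₂ (∈-oddGraph⁻ 0 t (graphFun-∈ graph fa)))

      ⊇img : toSub t ⊆ img f (evens n k)
      ⊇img {x} x∈ with ∈-map⁻ proj₂ (subst (toℕ x ∈_) (sym (values-oddGraph 0 t)) (∈-toSub⁻ x∈))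
      ... | (y , z) , p∈ , refl with reindex (proj₁ (∈-oddGraph⁻ 0 t p∈))
      ...   | a , refl , a∈ = ∈-img⁺ f a∈ (∈-graphFun graph p∈)

    ballotSet⇒∈ballots : ∀ {T} → BallotSet n k T → T ∈ ballots n k 2
    ballotSet⇒∈ballots (t , seq , refl , refl) = ∈-ballots⁺ (BallotSeq⇒BallotWord n 2 seq refl (ballotSeq<n seq refl))

  ∈ballots⇒ballotSet : ∀ {n k T} → T ∈ ballots n k 2 → BallotSet n k T
  ∈ballots⇒ballotSet {n} {k} T∈ = BallotWord⇒BallotSeq (∈-ballots⁻ n k 2 T∈) 0 1 refl

open OrbitOfEvens

module LinearAlgebra {c ℓ : Level} (F : Field c ℓ) (n : ℕ) where

  open import Data.Nat using (suc; _≤_; z≤n; s≤s)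
  open import Data.Nat.Properties using (≤-trans; n≤1+n; ≤-refl)
  import Data.Bool as Bool
  open import Data.Empty using (⊥-elim)
  open import Data.Fin.Subset using (Subset; _⊆_)
  open import Data.Fin.Subset.Properties using (_⊆?_)
  open import Data.Vec using (Vec; []; _∷_)
  import Data.Vec.Properties as VecP
  open import Data.Vec.Relation.Unary.All as VecAll using ([]; _∷_)
  open import Data.List using (List; []; _∷_; length)
  open import Data.List.Membership.Propositional using (_∈_; _∉_)
  open import Data.List.Relation.Unary.All as All using (All; []; _∷_)
  open import Data.List.Relation.Unary.AllPairs using ([]; _∷_)
  open import Data.List.Relation.Unary.Any using (here; there)
  open import Data.List.Relation.Unary.Unique.Propositional using (Unique)
  open import Data.List.Relation.Unary.Unique.Propositional.Properties using (Unique[x∷xs]⇒x∉xs)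
  open import Data.Product using (_×_; _,_)
  open import Function using (_∘_)
  open import Relation.Nullary using (¬_; Dec; yes; no; contradiction)
  open import Relation.Nullary.Decidable using (_×-dec_)
  open import Relation.Binary.PropositionalEquality as ≡ using (_≡_; _≢_)
  open Field F
  open IModule F n
  open import Algebra.Properties.CommutativeSemigroup +-commutativeSemigroup using (x∙yz≈y∙xz)
  open import Relation.Binary.Reasoning.Setoid setoid

  _≟ₛ_ : (S T : Subset n) → Dec (S ≡ T)
  _≟ₛ_ = VecP.≡-dec Bool._≟_

  open import Data.List.Membership.DecPropositional _≟ₛ_ using (_∈?_)

  coeff-++ : ∀ w u T → coeff (w +V u) T ≈ coeff w T + coeff u T
  coeff-++ []            u T = sym (+-identityˡ _)
  coeff-++ ((a , S) ∷ w) u T with S ≟ₛ T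
  ... | yes _ = trans (+-cong refl (coeff-++ w u T)) (sym (+-assoc _ _ _))
  ... | no  _ = coeff-++ w u T

  coeff-scale : ∀ a w T → coeff (a ·V w) T ≈ a * coeff w T
  coeff-scale a []            T = sym (zeroʳ a)
  coeff-scale a ((b , S) ∷ w) T with S ≟ₛ T
  ... | yes _ = trans (+-cong refl (coeff-scale a w T)) (sym (distribˡ a b _))
  ... | no  _ = coeff-scale a w T

  coeff-∷-≢ : ∀ a {S T} w → S ≢ T → coeff ((a , S) ∷ w) T ≈ coeff w T
  coeff-∷-≢ a {S} {T} w S≢T with S ≟ₛ T
  ... | yes S≡T = contradiction S≡T S≢T
  ... | no  _   = refl

  coeff-∷-≡ : ∀ a S w → coeff ((a , S) ∷ w) S ≈ a + coeff w S
  coeff-∷-≡ a S w with S ≟ₛ S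
  ... | yes _   = refl
  ... | no S≢S = contradiction ≡.refl S≢S

  remove : Subset n → V → V
  remove S []             = []
  remove S ((a , S′) ∷ w) with S′ ≟ₛ S
  ... | yes _ = remove S w
  ... | no  _ = (a , S′) ∷ remove S w

  length-remove : ∀ S w → length (remove S w) ≤ length w
  length-remove S []             = z≤n
  length-remove S ((a , S′) ∷ w) with S′ ≟ₛ S
  ... | yes _ = ≤-trans (length-remove S w) (n≤1+n _)
  ... | no  _ = s≤s (length-remove S w)

  length-remove-∷ : ∀ a S w → length (remove S ((a , S) ∷ w)) ≤ length w
  length-remove-∷ a S w with S ≟ₛ S
  ... | yes _   = length-remove S w
  ... | no S≢S = contradiction ≡.refl S≢S

  coeff-remove-≡ : ∀ S w → coeff (remove S w) S ≈ 0#
  coeff-remove-≡ S []             = refl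
  coeff-remove-≡ S ((a , S′) ∷ w) with S′ ≟ₛ S
  ... | yes _    = coeff-remove-≡ S w
  ... | no S′≢S = trans (coeff-∷-≢ a (remove S w) S′≢S) (coeff-remove-≡ S w)

  coeff-remove-≢ : ∀ S w {T} → T ≢ S → coeff (remove S w) T ≈ coeff w T
  coeff-remove-≢ S []             T≢S = refl
  coeff-remove-≢ S ((a , S′) ∷ w) {T} T≢S with S′ ≟ₛ S
  ... | yes ≡.refl = trans (coeff-remove-≢ S w T≢S) (sym (coeff-∷-≢ a w (λ S≡T → T≢S (≡.sym S≡T))))
  ... | no  _ with S′ ≟ₛ T
  ...   | yes _ = +-cong refl (coeff-remove-≢ S w T≢S)
  ...   | no  _ = coeff-remove-≢ S w T≢S

  Sends : IC n → Subset n → Subset n → Set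
  Sends f S T = S ⊆ dom f × img f S ≡ T

  sends? : ∀ f S T → Dec (Sends f S T)
  sends? f S T = (S ⊆? dom f) ×-dec (img f S ≟ₛ T)

  module _ (f : IC n) {T : Subset n} where

    act-∷-sends : ∀ a {S} w → Sends f S T → coeff (act f ((a , S) ∷ w)) T ≈ a + coeff (act f w) T
    act-∷-sends a {S} w (S⊆ , ≡.refl) with S ⊆? dom f
    ... | yes _   = coeff-∷-≡ a (img f S) (act f w)
    ... | no S⊈ = ⊥-elim (S⊈ S⊆)

    act-∷-¬sends : ∀ a {S} w → ¬ Sends f S T → coeff (act f ((a , S) ∷ w)) T ≈ coeff (act f w) T
    act-∷-¬sends a {S} w ¬sends with S ⊆? dom f
    ... | yes S⊆ = coeff-∷-≢ a (act f w) (λ img≡ → ¬sends (S⊆ , img≡))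
    ... | no  _  = refl

    coeff-act-remove : ∀ {S} → Sends f S T → ∀ w → coeff (act f w) T ≈ coeff w S + coeff (act f (remove S w)) T
    coeff-act-remove         sends []             = sym (+-identityˡ _)
    coeff-act-remove {S} sends ((b , S′) ∷ w) with S′ ≟ₛ S
    ... | yes ≡.refl = begin
      coeff (act f ((b , S) ∷ w)) T                      ≈⟨ act-∷-sends b w sends ⟩
      b + coeff (act f w) T                              ≈⟨ +-cong refl (coeff-act-remove sends w) ⟩
      b + (coeff w S + coeff (act f (remove S w)) T)     ≈⟨ +-assoc _ _ _ ⟨
      (b + coeff w S) + coeff (act f (remove S w)) T     ∎
    ... | no _ with sends? f S′ T
    ...   | yes sends′ = begin
      coeff (act f ((b , S′) ∷ w)) T                        ≈⟨ act-∷-sends b w sends′ ⟩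
      b + coeff (act f w) T                                 ≈⟨ +-cong refl (coeff-act-remove sends w) ⟩
      b + (coeff w S + coeff (act f (remove S w)) T)        ≈⟨ x∙yz≈y∙xz b _ _ ⟩
      coeff w S + (b + coeff (act f (remove S w)) T)        ≈⟨ +-cong refl (act-∷-sends b (remove S w) sends′) ⟨
      coeff w S + coeff (act f ((b , S′) ∷ remove S w)) T   ∎
    ...   | no ¬sends′ = begin
      coeff (act f ((b , S′) ∷ w)) T                        ≈⟨ act-∷-¬sends b w ¬sends′ ⟩
      coeff (act f w) T                                     ≈⟨ coeff-act-remove sends w ⟩
      coeff w S + coeff (act f (remove S w)) T              ≈⟨ +-cong refl (act-∷-¬sends b (remove S w) ¬sends′) ⟨
      coeff w S + coeff (act f ((b , S′) ∷ remove S w)) T   ∎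

    -- Induction on the length of w: removing all terms v_S of one preimage S of T
    -- strictly shortens the list.
    coeff-act≈0 : ∀ {bound} w → length w ≤ bound → (∀ {S} → Sends f S T → coeff w S ≈ 0#) → coeff (act f w) T ≈ 0#
    coeff-act≈0                      []             _           _      = refl
    coeff-act≈0 {suc bound} ((b , S) ∷ w) (s≤s |w|≤bound) vanish with sends? f S T
    ... | yes sends = begin
      coeff (act f ((b , S) ∷ w)) T                                          ≈⟨ coeff-act-remove sends ((b , S) ∷ w) ⟩
      coeff ((b , S) ∷ w) S + coeff (act f (remove S ((b , S) ∷ w))) T      ≈⟨ +-cong (vanish sends) rest≈0 ⟩
      0# + 0#                                                                ≈⟨ +-identityˡ 0# ⟩
      0#                                                                     ∎
      where
      vanish′ : ∀ {S′} → Sends f S′ T → coeff (remove S ((b , S) ∷ w)) S′ ≈ 0#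
      vanish′ {S′} sends′ with S′ ≟ₛ S
      ... | yes ≡.refl = coeff-remove-≡ S ((b , S) ∷ w)
      ... | no S′≢S    = trans (coeff-remove-≢ S ((b , S) ∷ w) S′≢S) (vanish sends′)
      rest≈0 : coeff (act f (remove S ((b , S) ∷ w))) T ≈ 0#
      rest≈0 = coeff-act≈0 (remove S ((b , S) ∷ w)) (≤-trans (length-remove-∷ b S w) |w|≤bound) vanish′
    ... | no ¬sends = trans (act-∷-¬sends b w ¬sends) (coeff-act≈0 w |w|≤bound vanish′)
      where
      vanish′ : ∀ {S′} → Sends f S′ T → coeff w S′ ≈ 0#
      vanish′ {S′} sends′ with S ≟ₛ S′
      ... | yes ≡.refl = contradiction sends′ ¬sends
      ... | no S≢S′    = trans (sym (coeff-∷-≢ b w S≢S′)) (vanish sends′)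

  v-img∈⟨v⟩ : ∀ f {S} → S ⊆ dom f → ⟨ v S ⟩ (v (img f S))
  v-img∈⟨v⟩ f {S} S⊆ = resp act≈ (acted f gen)
    where
    act≈ : act f (v S) ≈V v (img f S)
    act≈ T with S ⊆? dom f
    ... | yes _  = refl
    ... | no S⊈ = ⊥-elim (S⊈ S⊆)

  SupportedOn : (Subset n → Set) → V → Set ℓ
  SupportedOn P w = ∀ T → ¬ P T → coeff w T ≈ 0#

  module _ (P : Subset n → Set) (closed : ∀ f {S} → P S → S ⊆ dom f → P (img f S)) where

    act-supportedOn : ∀ f {w} → SupportedOn P w → SupportedOn P (act f w)
    act-supportedOn f {w} supp T ¬PT = coeff-act≈0 f w ≤-refl λ { (S⊆ , ≡.refl) → supp _ (λ PS → ¬PT (closed f PS S⊆)) }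

    ⟨⟩-supportedOn : ∀ {S} → P S → ∀ {w} → ⟨ v S ⟩ w → SupportedOn P w
    ⟨⟩-supportedOn {S} PS gen            T ¬PT = coeff-∷-≢ 1# [] (λ S≡T → ¬PT (≡.subst P S≡T PS))
    ⟨⟩-supportedOn     PS zer            T ¬PT = refl
    ⟨⟩-supportedOn     PS (add {w} {u} p q) T ¬PT = begin
      coeff (w +V u) T      ≈⟨ coeff-++ w u T ⟩
      coeff w T + coeff u T ≈⟨ +-cong (⟨⟩-supportedOn PS p T ¬PT) (⟨⟩-supportedOn PS q T ¬PT) ⟩
      0# + 0#               ≈⟨ +-identityˡ 0# ⟩
      0#                    ∎
    ⟨⟩-supportedOn     PS (scale a {w} p) T ¬PT = begin
      coeff (a ·V w) T ≈⟨ coeff-scale a w T ⟩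
      a * coeff w T    ≈⟨ *-cong refl (⟨⟩-supportedOn PS p T ¬PT) ⟩
      a * 0#           ≈⟨ zeroʳ a ⟩
      0#               ∎
    ⟨⟩-supportedOn     PS (acted f {w} p) = act-supportedOn f {w} (⟨⟩-supportedOn PS p)
    ⟨⟩-supportedOn     PS (resp w≈u p)   T ¬PT = trans (sym (w≈u T)) (⟨⟩-supportedOn PS p T ¬PT)

  basis : (L : List (Subset n)) → Vec V (length L)
  basis []      = []
  basis (T ∷ L) = v T ∷ basis L

  coordinates : V → (L : List (Subset n)) → Vec Carrier (length L)
  coordinates w []      = []
  coordinates w (T ∷ L) = coeff w T ∷ coordinates w L

  coeff-lincomb-∉ : ∀ L cs {T} → T ∉ L → coeff (lincomb cs (basis L)) T ≈ 0#
  coeff-lincomb-∉ []       []       _  = refl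
  coeff-lincomb-∉ (T′ ∷ L) (a ∷ cs) T∉ =
    trans (coeff-∷-≢ (a * 1#) _ (λ T′≡T → T∉ (here (≡.sym T′≡T)))) (coeff-lincomb-∉ L cs (T∉ ∘ there))

  coeff-lincomb-head : ∀ L cs a {T} → T ∉ L → coeff (lincomb (a ∷ cs) (basis (T ∷ L))) T ≈ a
  coeff-lincomb-head L cs a {T} T∉ = begin
    coeff (lincomb (a ∷ cs) (basis (T ∷ L))) T ≈⟨ coeff-∷-≡ (a * 1#) T _ ⟩
    a * 1# + coeff (lincomb cs (basis L)) T    ≈⟨ +-cong (*-identityʳ a) (coeff-lincomb-∉ L cs T∉) ⟩
    a + 0#                                     ≈⟨ +-identityʳ a ⟩
    a                                          ∎

  basis-linIndep : ∀ L → Unique L → LinIndep (basis L)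
  basis-linIndep []      _            []       _  = []
  basis-linIndep (T ∷ L) uniq@(_ ∷ uniqL) (a ∷ cs) ≈0 =
    trans (sym (coeff-lincomb-head L cs a T∉)) (≈0 T) ∷ basis-linIndep L uniqL cs ≈0′
    where
    T∉ = Unique[x∷xs]⇒x∉xs uniq
    ≈0′ : lincomb cs (basis L) ≈V 0V
    ≈0′ T′ with T ≟ₛ T′
    ... | yes ≡.refl = coeff-lincomb-∉ L cs T∉
    ... | no T≢T′    = trans (sym (coeff-∷-≢ (a * 1#) _ T≢T′)) (≈0 T′)

  coeff-lincomb-coordinates : ∀ L → Unique L → ∀ w {T} → T ∈ L → coeff (lincomb (coordinates w L) (basis L)) T ≈ coeff w T
  coeff-lincomb-coordinates (T ∷ L) uniq w (here ≡.refl) = coeff-lincomb-head L (coordinates w L) (coeff w T) (Unique[x∷xs]⇒x∉xs uniq)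
  coeff-lincomb-coordinates (T′ ∷ L) uniq@(_ ∷ uniqL) w {T} (there T∈) =
    trans (coeff-∷-≢ _ _ (λ T′≡T → Unique[x∷xs]⇒x∉xs uniq (≡.subst (_∈ L) (≡.sym T′≡T) T∈)))
          (coeff-lincomb-coordinates L uniqL w T∈)

  hasDim-basis : ∀ {p} (P : V → Set p) (L : List (Subset n)) → Unique L →
                 All (λ T → P (v T)) L → (∀ {w} → P w → SupportedOn (_∈ L) w) → HasDim P (length L)
  hasDim-basis P L uniq vT∈P supported =
    basis L , basis⊆P L vT∈P , basis-linIndep L uniq , λ w Pw → coordinates w L , spans w Pw
    where
    basis⊆P : ∀ L → All (λ T → P (v T)) L → VecAll.All P (basis L)
    basis⊆P []      []           = []
    basis⊆P (T ∷ L) (PvT ∷ PvL) = PvT ∷ basis⊆P L PvL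
    spans : ∀ w → P w → lincomb (coordinates w L) (basis L) ≈V w
    spans w Pw T with T ∈? L
    ... | yes T∈ = coeff-lincomb-coordinates L uniq w T∈
    ... | no  T∉ = trans (coeff-lincomb-∉ L (coordinates w L) T∉) (sym (supported Pw T T∉))

open import Data.Nat using (suc; _*_; _≤_)
import Data.List.Relation.Unary.All as All
open import Data.Product using (_,_)
open import Function using (_∘_)
open import Relation.Binary.PropositionalEquality using (refl; subst)

corollary4p7 : ∀ {c ℓ : Level} (F : Field c ℓ) → Field.CharZero F →
    (n k : ℕ) → 2 * k ≤ n →
    IModule.HasDim F n (IModule.⟨_⟩ F n (IModule.v F n (evens n k))) (catalan (suc k))
corollary4p7 F _ n k 2k≤n =
  subst (HasDim ⟨ v (evens n k) ⟩) (length-ballots≡catalan n k 2k≤n)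
        (hasDim-basis ⟨ v (evens n k) ⟩ (ballots n k 2) (ballots-unique n k 2)
                      (All.tabulate (v∈⟨v-evens⟩ ∘ ∈ballots⇒ballotSet))
                      λ w∈ T T∉ → ⟨⟩-supportedOn (BallotSet n k) (img-ballotSet 2k≤n) (evens-ballotSet 2k≤n) w∈ T
                                                  (T∉ ∘ ballotSet⇒∈ballots 2k≤n))
  where
  open IModule F n
  open LinearAlgebra F n

  v∈⟨v-evens⟩ : ∀ {T} → BallotSet n k T → ⟨ v (evens n k) ⟩ (v T)
  v∈⟨v-evens⟩ T∈ with ballotSet-reachable 2k≤n T∈
  ... | f , evens⊆dom , refl = v-img∈⟨v⟩ f evens⊆dom
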